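{- Let $b,c$ be nonzero constants and let the polynomials $P_n(x)$ be defined by $P_0(x)=1$, $P_1(x)=x-c$ and $P_n(x)=(x-c)P_{n-1}(x)-bxP_{n-2}(x)$ for $n\ge 2$. Then for all $n\ge 0$, $$P_n(x)=\sum_{k=0}^n \left(\sum_{j=0}^k \binom{k}{j}\binom{n-j}{n-k-j}(-b)^j(-c)^{n-k-j}\right)x^k.$$
   Context: Binomial coefficients $\binom{m}{r}$ with $r<0$ are taken to be $0$. -}

module Defs where

open import Level using (Level)
open import Data.Nat using (ℕ; zero; suc; _∸_; _≤_; _<_; _≤?_)
open import Data.Nat.Combinatorics using (_C_)
open import Relation.Nullary using (yes; no)
open import Algebra.Bundles using (CommutativeRing)

module Poly {c ℓ : Level} (R : CommutativeRing c ℓ) where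
  open CommutativeRing R hiding (zero)

  -- A polynomial over R is represented by its coefficient sequence:
  -- p k is the coefficient of x^k.
  Pol : Set c
  Pol = ℕ → Carrier

  const : Carrier → Pol
  const a zero    = a
  const a (suc k) = 0#

  X : Pol
  X zero          = 0#
  X (suc zero)    = 1#
  X (suc (suc k)) = 0#

  _⊕_ : Pol → Pol → Pol
  (p ⊕ q) k = p k + q k

  ⊖_ : Pol → Pol
  (⊖ p) k = - (p k)

  _·_ : Carrier → Pol → Pol
  (a · p) k = a * p k

  x⊗ : Pol → Pol
  x⊗ p zero    = 0#
  x⊗ p (suc k) = p k

  xMinus_⊗_ : Carrier → Pol → Pol
  xMinus a ⊗ p = x⊗ p ⊕ (⊖ (a · p))

  P : (b c : Carrier) → ℕ → Pol
  P b c zero          = const 1#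
  P b c (suc zero)    = X ⊕ (⊖ const c)
  P b c (suc (suc n)) = (xMinus c ⊗ P b c (suc n)) ⊕ (⊖ (b · x⊗ (P b c n)))

  fromℕ : ℕ → Carrier
  fromℕ zero    = 0#
  fromℕ (suc n) = 1# + fromℕ n

  _^_ : Carrier → ℕ → Carrier
  a ^ zero  = 1#
  a ^ suc n = a * (a ^ n)

  sumTo : ℕ → (ℕ → Carrier) → Carrier
  sumTo zero    f = f zero
  sumTo (suc n) f = sumTo n f + f (suc n)

  -- The summand binom(k,j) binom(n-j, n-k-j) (-b)^j (-c)^(n-k-j),
  -- where the binomial with negative lower index (k + j > n) is 0.
  term : (b c : Carrier) (n k j : ℕ) → Carrier
  term b c n k j with k Data.Nat.+ j ≤? n
  ... | yes _ = fromℕ (k C j) * fromℕ ((n ∸ j) C (n ∸ k ∸ j))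
                  * ((- b) ^ j) * ((- c) ^ (n ∸ k ∸ j))
  ... | no _  = 0#

  rhsCoeff : (b c : Carrier) (n k : ℕ) → Carrier
  rhsCoeff b c n k = sumTo k (term b c n k)

  RHS : (b c : Carrier) → ℕ → Pol
  RHS b c n k with k ≤? n
  ... | yes _ = rhsCoeff b c n k
  ... | no _  = 0#

-- Put β = -b, γ = -c and write n = k + j + m.  The j-th summand of the coefficient of x^k
-- is then A k j * B k m, where A k and B k are the coefficient sequences of (1 + β y)^k and
-- (1 - γ y)^-(k+1).  Pascal's rule says A (k+1) = (1 + β y) A k and (1 - γ y) B (k+1) = B k;
-- multiplying the two shows that the summands, hence the coefficients, obey the three-term
-- recurrence of P_n, and a sequence of polynomials is determined by that recurrence and its
-- first two members.

module Submission where

open import Defs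
open import Level using (Level)
open import Data.Nat as ℕ using (ℕ; zero; suc; z≤n; s≤s; _≤?_)
import Data.Nat.Properties as ℕₚ
open import Data.Nat.Combinatorics using (_C_; nCn≡1; nCk≡nC[n∸k]; nCk+nC[k+1]≡[n+1]C[k+1]; k>n⇒nCk≡0)
open import Data.Product using (∃-syntax; _,_)
open import Data.Sum using (_⊎_; inj₁; inj₂)
open import Relation.Nullary using (¬_; yes; no)
open import Relation.Nullary.Negation using (contradiction)
open import Relation.Binary.PropositionalEquality as ≡ using (_≡_; cong; cong₂)
open import Algebra.Bundles using (CommutativeRing)
import Algebra.Properties.Ring as RingProperties
import Algebra.Properties.CommutativeSemigroup as CommutativeSemigroupProperties
import Algebra.Solver.Ring.NaturalCoefficients.Default as NaturalCoefficientsSolver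
import Relation.Binary.Reasoning.Setoid as SetoidReasoning

≤⊎>-witness : ∀ m n → (∃[ o ] n ≡ m ℕ.+ o) ⊎ n ℕ.< m
≤⊎>-witness m n with m ≤? n
... | yes m≤n = let o , m+o≡n = ℕₚ.m≤n⇒∃[o]m+o≡n m≤n in inj₁ (o , ≡.sym m+o≡n)
... | no m≰n  = inj₂ (ℕₚ.≰⇒> m≰n)

nC0≡1 : ∀ n → n C 0 ≡ 1
nC0≡1 n = ≡.trans (nCk≡nC[n∸k] {n = n} z≤n) (nCn≡1 n)

module PolyProperties {a ℓ : Level} (R : CommutativeRing a ℓ) where
  open CommutativeRing R hiding (zero)
  open Poly R

  infix 4 _≋_
  _≋_ : Pol → Pol → Set ℓ
  p ≋ q = ∀ k → p k ≈ q k

  ⊕-cong : ∀ {p p′ q q′} → p ≋ p′ → q ≋ q′ → p ⊕ q ≋ p′ ⊕ q′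
  ⊕-cong p≋p′ q≋q′ k = +-cong (p≋p′ k) (q≋q′ k)

  ⊖-cong : ∀ {p q} → p ≋ q → ⊖ p ≋ ⊖ q
  ⊖-cong p≋q k = -‿cong (p≋q k)

  ·-congˡ : ∀ s {p q} → p ≋ q → s · p ≋ s · q
  ·-congˡ s p≋q k = *-congˡ (p≋q k)

  x⊗-cong : ∀ {p q} → p ≋ q → x⊗ p ≋ x⊗ q
  x⊗-cong p≋q zero    = refl
  x⊗-cong p≋q (suc k) = p≋q k

  xMinus-⊗-cong : ∀ s {p q} → p ≋ q → xMinus s ⊗ p ≋ xMinus s ⊗ q
  xMinus-⊗-cong s p≋q = ⊕-cong (x⊗-cong p≋q) (⊖-cong (·-congˡ s p≋q))

  P-unique : ∀ b c (q : ℕ → Pol) → P b c 0 ≋ q 0 → P b c 1 ≋ q 1 →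
             (∀ n → (xMinus c ⊗ q (suc n)) ⊕ (⊖ (b · x⊗ (q n))) ≋ q (suc (suc n))) →
             ∀ n → P b c n ≋ q n
  P-unique b c q q₀ q₁ step zero          = q₀
  P-unique b c q q₀ q₁ step (suc zero)    = q₁
  P-unique b c q q₀ q₁ step (suc (suc n)) k = trans
    (⊕-cong (xMinus-⊗-cong c (P-unique b c q q₀ q₁ step (suc n)))
            (⊖-cong (·-congˡ b (x⊗-cong (P-unique b c q q₀ q₁ step n)))) k)
    (step n k)

  fromℕ-+ : ∀ m n → fromℕ (m ℕ.+ n) ≈ fromℕ m + fromℕ n
  fromℕ-+ zero    n = sym (+-identityˡ (fromℕ n))
  fromℕ-+ (suc m) n = trans (+-congˡ (fromℕ-+ m n)) (sym (+-assoc 1# (fromℕ m) (fromℕ n)))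

  fromℕ-pascal : ∀ n k → fromℕ (suc n C suc k) ≈ fromℕ (n C k) + fromℕ (n C suc k)
  fromℕ-pascal n k = trans (reflexive (cong fromℕ (≡.sym (nCk+nC[k+1]≡[n+1]C[k+1] n k))))
                           (fromℕ-+ (n C k) (n C suc k))

  sumTo-cong : ∀ n {f g} → f ≋ g → sumTo n f ≈ sumTo n g
  sumTo-cong zero    f≋g = f≋g zero
  sumTo-cong (suc n) f≋g = +-cong (sumTo-cong n f≋g) (f≋g (suc n))

  sumTo-zero : ∀ n {f} → (∀ j → f j ≈ 0#) → sumTo n f ≈ 0#
  sumTo-zero zero    f≈0 = f≈0 zero
  sumTo-zero (suc n) f≈0 = trans (+-cong (sumTo-zero n f≈0) (f≈0 (suc n))) (+-identityʳ 0#)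

  sumTo-+ : ∀ n f g → sumTo n (λ j → f j + g j) ≈ sumTo n f + sumTo n g
  sumTo-+ zero    f g = refl
  sumTo-+ (suc n) f g = trans (+-congʳ (sumTo-+ n f g)) (+-interchange _ _ _ _)
    where open CommutativeSemigroupProperties +-commutativeSemigroup
            renaming (interchange to +-interchange)

  sumTo-*ˡ : ∀ n s f → sumTo n (λ j → s * f j) ≈ s * sumTo n f
  sumTo-*ˡ zero    s f = refl
  sumTo-*ˡ (suc n) s f = trans (+-congʳ (sumTo-*ˡ n s f)) (sym (distribˡ s _ _))

  sumTo-x⊗ : ∀ n f → sumTo (suc n) (x⊗ f) ≈ sumTo n f
  sumTo-x⊗ zero    f = +-identityˡ (f zero)
  sumTo-x⊗ (suc n) f = +-congʳ (sumTo-x⊗ n f)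

module Coefficients {a ℓ : Level} (R : CommutativeRing a ℓ) (b c : CommutativeRing.Carrier R) where
  open CommutativeRing R hiding (zero)
  open Poly R
  open PolyProperties R
  open RingProperties ring using (-‿distribˡ-*; -0#≈0#)
  open CommutativeSemigroupProperties *-commutativeSemigroup using (interchange; x∙yz≈y∙xz)
  open NaturalCoefficientsSolver commutativeSemiring using (solve; _:=_; _:+_; _:*_; con)
  open SetoidReasoning setoid

  β γ : Carrier
  β = - b
  γ = - c

  A B : ℕ → Pol
  A k j = fromℕ (k C j) * β ^ j
  B k m = fromℕ ((k ℕ.+ m) C m) * γ ^ m

  A-zero : ∀ k → A k 0 ≈ 1#
  A-zero k = trans (*-identityʳ _) (trans (reflexive (cong fromℕ (nC0≡1 k))) (+-identityʳ 1#))

  B-zero : ∀ k → B k 0 ≈ 1#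
  B-zero k = trans (*-identityʳ _) (trans (reflexive (cong fromℕ (nC0≡1 (k ℕ.+ 0)))) (+-identityʳ 1#))

  A-superdiagonal : ∀ {k j} → k ℕ.< j → A k j ≈ 0#
  A-superdiagonal k<j = trans (*-congʳ (reflexive (cong fromℕ (k>n⇒nCk≡0 k<j)))) (zeroˡ _)

  pascal-rearrange : ∀ s x y g → (x + y) * (s * g) ≈ y * (s * g) + s * (x * g)
  pascal-rearrange = solve 4 (λ s x y g → (x :+ y) :* (s :* g) := y :* (s :* g) :+ s :* (x :* g)) refl

  A-pascal : ∀ k j → A (suc k) j ≈ A k j + β * x⊗ (A k) j
  A-pascal k zero    = trans (A-zero (suc k)) (sym (trans (+-cong (A-zero k) (zeroʳ β)) (+-identityʳ 1#)))
  A-pascal k (suc j) = trans (*-congʳ (fromℕ-pascal k j)) (pascal-rearrange β _ _ _)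

  B-pascal : ∀ k m → B (suc k) m ≈ B k m + γ * x⊗ (B (suc k)) m
  B-pascal k zero    = trans (B-zero (suc k)) (sym (trans (+-cong (B-zero k) (zeroʳ γ)) (+-identityʳ 1#)))
  B-pascal k (suc m) = begin
    fromℕ (suc n C suc m) * γ ^ suc m              ≈⟨ *-congʳ (fromℕ-pascal n m) ⟩
    (fromℕ (n C m) + fromℕ (n C suc m)) * γ ^ suc m ≈⟨ pascal-rearrange γ _ _ _ ⟩
    B k (suc m) + γ * (fromℕ (n C m) * γ ^ m)
      ≡⟨ cong (λ i → B k (suc m) + γ * (fromℕ (i C m) * γ ^ m)) (ℕₚ.+-suc k m) ⟩
    B k (suc m) + γ * B (suc k) m                   ∎
    where n = k ℕ.+ suc m

  B-diagonal-step : ∀ m → B 0 (suc m) ≈ γ * B 0 m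
  B-diagonal-step m = begin
    fromℕ (suc m C suc m) * (γ * γ ^ m)
      ≡⟨ cong (λ i → fromℕ i * (γ * γ ^ m)) (≡.trans (nCn≡1 (suc m)) (≡.sym (nCn≡1 m))) ⟩
    fromℕ (m C m) * (γ * γ ^ m)
      ≈⟨ x∙yz≈y∙xz _ γ _ ⟩
    γ * B 0 m ∎

  term-split : ∀ {n} k j m → n ≡ k ℕ.+ j ℕ.+ m → term b c n k j ≈ A k j * B k m
  term-split k j m ≡.refl with k ℕ.+ j ≤? k ℕ.+ j ℕ.+ m
  ... | no k+j≰n = contradiction (ℕₚ.m≤m+n (k ℕ.+ j) m) k+j≰n
  ... | yes _    = begin
    fromℕ (k C j) * fromℕ ((n ℕ.∸ j) C (n ℕ.∸ k ℕ.∸ j)) * β ^ j * γ ^ (n ℕ.∸ k ℕ.∸ j)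
      ≡⟨ cong₂ (λ p q → fromℕ (k C j) * fromℕ (p C q) * β ^ j * γ ^ q) n∸j≡k+m n∸k∸j≡m ⟩
    fromℕ (k C j) * fromℕ ((k ℕ.+ m) C m) * β ^ j * γ ^ m
      ≈⟨ *-assoc _ _ _ ⟩
    fromℕ (k C j) * fromℕ ((k ℕ.+ m) C m) * (β ^ j * γ ^ m)
      ≈⟨ interchange _ _ _ _ ⟩
    A k j * B k m ∎
    where
    n = k ℕ.+ j ℕ.+ m
    n∸j≡k+m : n ℕ.∸ j ≡ k ℕ.+ m
    n∸j≡k+m = ≡.trans (cong (ℕ._∸ j) (≡.trans (cong (ℕ._+ m) (ℕₚ.+-comm k j)) (ℕₚ.+-assoc j k m)))
                      (ℕₚ.m+n∸m≡n j (k ℕ.+ m))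
    n∸k∸j≡m : n ℕ.∸ k ℕ.∸ j ≡ m
    n∸k∸j≡m = ≡.trans (ℕₚ.∸-+-assoc n k j) (ℕₚ.m+n∸m≡n (k ℕ.+ j) m)

  term-beyond : ∀ {n} k j → n ℕ.< k ℕ.+ j → term b c n k j ≈ 0#
  term-beyond {n} k j n<k+j with k ℕ.+ j ≤? n
  ... | yes k+j≤n = contradiction k+j≤n (ℕₚ.<⇒≱ n<k+j)
  ... | no _      = refl

  term-superdiagonal : ∀ n {k j} → k ℕ.< j → term b c n k j ≈ 0#
  term-superdiagonal n {k} {j} k<j with ≤⊎>-witness (k ℕ.+ j) n
  ... | inj₁ (m , n≡k+j+m) =
    trans (term-split k j m n≡k+j+m) (trans (*-congʳ (A-superdiagonal k<j)) (zeroˡ _))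
  ... | inj₂ n<k+j = term-beyond k j n<k+j

  term-x⊗-B : ∀ {n k j} m → suc n ≡ k ℕ.+ j ℕ.+ m →
              term b c (suc n) (suc k) j ≈ A (suc k) j * x⊗ (B (suc k)) m
  term-x⊗-B {k = k} {j} zero eq =
    trans (term-beyond (suc k) j (s≤s (ℕₚ.≤-reflexive (≡.trans eq (ℕₚ.+-identityʳ (k ℕ.+ j))))))
          (sym (zeroʳ _))
  term-x⊗-B {k = k} {j} (suc m) eq = term-split (suc k) j m (≡.trans eq (ℕₚ.+-suc (k ℕ.+ j) m))

  x⊗-term : ∀ {n k} j m → suc n ≡ k ℕ.+ j ℕ.+ m → x⊗ (term b c n k) j ≈ x⊗ (A k) j * B k m
  x⊗-term zero m eq = sym (zeroˡ _)
  x⊗-term {k = k} (suc j) m eq =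
    term-split k j m (ℕₚ.suc-injective (≡.trans eq (cong (ℕ._+ m) (ℕₚ.+-suc k j))))

  x⊗-term-beyond : ∀ {n k} j → suc n ℕ.< k ℕ.+ j → x⊗ (term b c n k) j ≈ 0#
  x⊗-term-beyond zero _ = refl
  x⊗-term-beyond {n} {k} (suc j) lt =
    term-beyond k j (ℕ.s≤s⁻¹ (≡.subst (suc n ℕ.<_) (ℕₚ.+-suc k j) lt))

  regroup : ∀ s t x y u v → (x + s * y) * u + t * v ≈ (x * u + t * v) + s * (y * u)
  regroup = solve 6 (λ s t x y u v → (x :+ s :* y) :* u :+ t :* v := (x :* u :+ t :* v) :+ s :* (y :* u)) refl

  combine-zeros : ∀ s t → (0# + s * 0#) + t * 0# ≈ 0#
  combine-zeros = solve 2 (λ s t → (con 0 :+ s :* con 0) :+ t :* con 0 := con 0) refl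

  term-step : ∀ n k j → term b c (suc (suc n)) (suc k) j
              ≈ (term b c (suc n) k j + γ * term b c (suc n) (suc k) j) + β * x⊗ (term b c n k) j
  term-step n k j with ≤⊎>-witness (k ℕ.+ j) (suc n)
  ... | inj₁ (m , eq) = begin
    term b c (suc (suc n)) (suc k) j
      ≈⟨ term-split (suc k) j m (cong suc eq) ⟩
    A (suc k) j * B (suc k) m
      ≈⟨ *-congˡ (B-pascal k m) ⟩
    A (suc k) j * (B k m + γ * x⊗ (B (suc k)) m)
      ≈⟨ distribˡ _ _ _ ⟩
    A (suc k) j * B k m + A (suc k) j * (γ * x⊗ (B (suc k)) m)
      ≈⟨ +-cong (*-congʳ (A-pascal k j)) (x∙yz≈y∙xz _ γ _) ⟩
    (A k j + β * x⊗ (A k) j) * B k m + γ * (A (suc k) j * x⊗ (B (suc k)) m)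
      ≈⟨ regroup β γ _ _ _ _ ⟩
    (A k j * B k m + γ * (A (suc k) j * x⊗ (B (suc k)) m)) + β * (x⊗ (A k) j * B k m)
      ≈⟨ +-cong (+-cong (term-split k j m eq) (*-congˡ (term-x⊗-B m eq))) (*-congˡ (x⊗-term j m eq)) ⟨
    (term b c (suc n) k j + γ * term b c (suc n) (suc k) j) + β * x⊗ (term b c n k) j ∎
  ... | inj₂ lt = trans (term-beyond (suc k) j (s≤s lt)) (sym (trans
    (+-cong (+-cong (term-beyond k j lt) (*-congˡ (term-beyond (suc k) j (ℕₚ.m<n⇒m<1+n lt))))
            (*-congˡ (x⊗-term-beyond j lt)))
    (combine-zeros γ β)))

  rhsCoeff-beyond : ∀ {n} k → n ℕ.< k → rhsCoeff b c n k ≈ 0#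
  rhsCoeff-beyond k n<k = sumTo-zero k (λ j → term-beyond k j (ℕₚ.≤-trans n<k (ℕₚ.m≤m+n k j)))

  RHS≈rhsCoeff : ∀ n k → RHS b c n k ≈ rhsCoeff b c n k
  RHS≈rhsCoeff n k with k ≤? n
  ... | yes _   = refl
  ... | no k≰n  = sym (rhsCoeff-beyond k (ℕₚ.≰⇒> k≰n))

  rhsCoeff-step-zero : ∀ n → rhsCoeff b c (suc (suc n)) 0 ≈ γ * rhsCoeff b c (suc n) 0
  rhsCoeff-step-zero n = begin
    term b c (suc (suc n)) 0 0     ≈⟨ term-split 0 0 (suc (suc n)) ≡.refl ⟩
    A 0 0 * B 0 (suc (suc n))      ≈⟨ *-congˡ (B-diagonal-step (suc n)) ⟩
    A 0 0 * (γ * B 0 (suc n))      ≈⟨ x∙yz≈y∙xz _ γ _ ⟩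
    γ * (A 0 0 * B 0 (suc n))      ≈⟨ *-congˡ (term-split 0 0 (suc n) ≡.refl) ⟨
    γ * term b c (suc n) 0 0       ∎

  rhsCoeff-step-suc : ∀ n k → rhsCoeff b c (suc (suc n)) (suc k)
                      ≈ (rhsCoeff b c (suc n) k + γ * rhsCoeff b c (suc n) (suc k)) + β * rhsCoeff b c n k
  rhsCoeff-step-suc n k = begin
    sumTo (suc k) (term b c (suc (suc n)) (suc k))
      ≈⟨ sumTo-cong (suc k) (term-step n k) ⟩
    sumTo (suc k) (λ j → (t₁ j + γ * t₂ j) + β * x⊗ t₀ j)
      ≈⟨ trans (sumTo-+ (suc k) (λ j → t₁ j + γ * t₂ j) (λ j → β * x⊗ t₀ j))
               (+-cong (trans (sumTo-+ (suc k) t₁ (λ j → γ * t₂ j)) (+-congˡ (sumTo-*ˡ (suc k) γ t₂)))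
                       (sumTo-*ˡ (suc k) β (x⊗ t₀))) ⟩
    (sumTo (suc k) t₁ + γ * sumTo (suc k) t₂) + β * sumTo (suc k) (x⊗ t₀)
      ≈⟨ +-cong (+-congʳ (trans (+-congˡ (term-superdiagonal (suc n) (ℕₚ.n<1+n k))) (+-identityʳ _)))
                (*-congˡ (sumTo-x⊗ k t₀)) ⟩
    (sumTo k t₁ + γ * sumTo (suc k) t₂) + β * sumTo k t₀ ∎
    where
    t₀ t₁ t₂ : Pol
    t₀ = term b c n k
    t₁ = term b c (suc n) k
    t₂ = term b c (suc n) (suc k)

  pad-with-zeros : ∀ s t y → s * y ≈ (0# + s * y) + t * 0#
  pad-with-zeros = solve 3 (λ s t y → s :* y := (con 0 :+ s :* y) :+ t :* con 0) refl

  rhsCoeff-recurrence : ∀ n → (xMinus c ⊗ rhsCoeff b c (suc n)) ⊕ (⊖ (b · x⊗ (rhsCoeff b c n)))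
                              ≋ rhsCoeff b c (suc (suc n))
  rhsCoeff-recurrence n zero    = sym (trans (rhsCoeff-step-zero n)
    (trans (pad-with-zeros γ β _) (sym (+-cong (+-congˡ (-‿distribˡ-* c _)) (-‿distribˡ-* b 0#)))))
  rhsCoeff-recurrence n (suc k) = trans (+-cong (+-congˡ (-‿distribˡ-* c _)) (-‿distribˡ-* b _))
                                        (sym (rhsCoeff-step-suc n k))

  rhsCoeff-initial₀ : P b c 0 ≋ rhsCoeff b c 0
  rhsCoeff-initial₀ zero    =
    sym (trans (term-split 0 0 0 ≡.refl) (trans (*-cong (A-zero 0) (B-zero 0)) (*-identityˡ 1#)))
  rhsCoeff-initial₀ (suc k) = sym (rhsCoeff-beyond (suc k) (s≤s z≤n))

  rhsCoeff-initial₁ : P b c 1 ≋ rhsCoeff b c 1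
  rhsCoeff-initial₁ zero = sym (begin
    term b c 1 0 0       ≈⟨ term-split 0 0 1 ≡.refl ⟩
    A 0 0 * B 0 1        ≈⟨ *-cong (A-zero 0) (B-diagonal-step 0) ⟩
    1# * (γ * B 0 0)     ≈⟨ trans (*-identityˡ _) (*-congˡ (B-zero 0)) ⟩
    γ * 1#               ≈⟨ trans (+-identityˡ γ) (sym (*-identityʳ γ)) ⟨
    0# + - c             ∎)
  rhsCoeff-initial₁ (suc zero) = sym (begin
    term b c 1 1 0 + term b c 1 1 1  ≈⟨ +-cong (term-split 1 0 0 ≡.refl) (term-beyond 1 1 (s≤s (s≤s z≤n))) ⟩
    A 1 0 * B 1 0 + 0#               ≈⟨ +-congʳ (trans (*-cong (A-zero 1) (B-zero 1)) (*-identityˡ 1#)) ⟩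
    1# + 0#                          ≈⟨ +-congˡ -0#≈0# ⟨
    1# + - 0#                        ∎)
  rhsCoeff-initial₁ (suc (suc k)) =
    trans (+-identityˡ _) (trans -0#≈0# (sym (rhsCoeff-beyond (suc (suc k)) (s≤s (s≤s z≤n)))))

mainTheorem2 : {ℓc ℓ : Level} (R : CommutativeRing ℓc ℓ) →
    let open CommutativeRing R in
    (b c : Carrier) → ¬ (b ≈ 0#) → ¬ (c ≈ 0#) →
    (n k : ℕ) → Poly.P R b c n k ≈ Poly.RHS R b c n k
mainTheorem2 R b c _ _ n k =
  trans (P-unique b c (rhsCoeff b c) rhsCoeff-initial₀ rhsCoeff-initial₁ rhsCoeff-recurrence n k)
        (sym (RHS≈rhsCoeff n k))
  where
  open CommutativeRing R using (trans; sym)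
  open Poly R using (rhsCoeff)
  open PolyProperties R using (P-unique)
  open Coefficients R b c using (rhsCoeff-initial₀; rhsCoeff-initial₁; rhsCoeff-recurrence; RHS≈rhsCoeff)
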